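{- Let $\mathcal{H}$ be a hereditary family, let $X \subseteq Y$ be sets, and let $\mathcal{G} = \{H \in \mathcal{H} \colon H \cap Y = X\}$. If $\mathcal{G} \neq \emptyset$, then \[\mu(\{G \setminus X \colon G \in \mathcal{G}\}) \geq \mu(\mathcal{H}) - |Y|.\]
   Context: All sets and families (sets of sets) are finite. A family $\mathcal{H}$ is hereditary if for every $A \in \mathcal{H}$, every subset of $A$ is in $\mathcal{H}$. A set $B \in \mathcal{F}$ is a base of a family $\mathcal{F}$ if $B$ is not a proper subset of any $A \in \mathcal{F}$; $\mu(\mathcal{F})$ is the size of a smallest base of $\mathcal{F}$. -}

module Defs where

open import Data.Nat using (ℕ; _⊓_)
open import Data.Bool using (Bool)
import Data.Bool.Properties as BoolP
open import Data.List using (List; []; _∷_; foldr; map; filter)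
open import Data.List.Membership.Propositional using (_∈_)
open import Data.List.Relation.Unary.All using (All; all?)
open import Data.Fin.Subset using (Subset; _⊆_; _⊂_; _∩_; _─_; ∣_∣)
open import Data.Fin.Subset.Properties using (_⊂?_)
open import Data.Vec.Properties using (≡-dec)
open import Relation.Nullary using (¬_; ¬?)
open import Relation.Binary.PropositionalEquality using (_≡_)
open import Relation.Binary using (DecidableEquality)

-- A (finite) family of subsets of the ground set Fin n, given as a list
-- (membership is list membership; duplicates are irrelevant).
Family : ℕ → Set
Family n = List (Subset n)

_≟ˢ_ : ∀ {n} → DecidableEquality (Subset n)
_≟ˢ_ = ≡-dec BoolP._≟_

Hereditary : ∀ {n} → Family n → Set
Hereditary {n} ℋ = ∀ {A B : Subset n} → A ∈ ℋ → B ⊆ A → B ∈ ℋ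

IsBase : ∀ {n} → Family n → Subset n → Set
IsBase ℱ B = B ∈ ℱ × (∀ {A} → A ∈ ℱ → ¬ (B ⊂ A))
  where open import Data.Product using (_×_)

maximal? : ∀ {n} (ℱ : Family n) (B : Subset n) → _
maximal? ℱ B = all? (λ A → ¬? (B ⊂? A)) ℱ

bases : ∀ {n} → Family n → Family n
bases ℱ = filter (maximal? ℱ) ℱ

-- minimum of a list of naturals (0 for the empty list; never used on empty lists below)
minimum : List ℕ → ℕ
minimum []       = 0
minimum (x ∷ xs) = foldr _⊓_ x xs

μ : ∀ {n} → Family n → ℕ
μ ℱ = minimum (map ∣_∣ (bases ℱ))

restrict : ∀ {n} → Family n → Subset n → Subset n → Family n
restrict ℋ X Y = filter (λ H → (H ∩ Y) ≟ˢ X) ℋ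

removeAll : ∀ {n} → Family n → Subset n → Family n
removeAll 𝒢 X = map (λ G → G ─ X) 𝒢

-- Let G ∖ X (G ∈ 𝒢) be a smallest base of {G ∖ X : G ∈ 𝒢} and extend G to a base M
-- of ℋ. As ℋ is hereditary and X = G ∩ Y ⊆ M, the set H = (M ∖ Y) ∪ X lies in 𝒢, and
-- H ∖ X = M ∖ Y ⊇ G ∖ X. Maximality of G ∖ X forces M ∖ Y ⊆ G ∖ X, whence
-- μ(ℋ) ≤ |M| ≤ |Y| + |M ∖ Y| ≤ |Y| + |G ∖ X|.
module Submission where

open import Defs
open import Data.Nat using (ℕ; _≤_; _∸_)
open import Data.List using ([])
open import Data.Fin.Subset using (Subset; _⊆_; ∣_∣)
open import Relation.Nullary using (¬_)
open import Relation.Binary.PropositionalEquality using (_≡_)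

open import Data.Nat using (suc; _+_; _⊓_; z≤n; s≤s)
open import Data.Nat.Properties
  using (module ≤-Reasoning; ≤-refl; ≤-trans; m⊓n≤m; m⊓n≤n; ⊓-sel; +-suc; n≤1+n; +-monoʳ-≤; m≤n+o⇒m∸n≤o)
open import Data.Fin using (Fin; zero)
open import Data.Fin.Subset using (_⊂_; _⊃_; _∩_; _∪_; _─_; _∈_; _∉_; inside; outside)
open import Data.Fin.Subset.Properties
  using (_∈?_; _⊂?_; p⊂q⇒p⊆q; p─q⊆p; p⊆q⇒∣p∣≤∣q∣; ⊆-reflexive; ⊆-antisym; x∈p∧x∉q⇒x∈p─q; x∈p∩q⁺; x∈p∩q⁻; x∈p∪q⁺; x∈p∪q⁻)
open import Data.Fin.Subset.Induction using (Acc; acc; ⊃-wellFounded)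
open import Data.Vec using ([]; _∷_; here; there)
open import Data.List using (List; _∷_)
import Data.List.Membership.Propositional as List
open import Data.List.Membership.Propositional.Properties using (∈-filter⁺; ∈-filter⁻; ∈-map⁺; ∈-map⁻; foldr-selective)
open import Data.List.Properties using (foldr-preservesᵒ)
open import Data.List.Relation.Unary.Any as Any using (here; there)
open import Data.List.Relation.Unary.All using (lookup)
open import Data.List.Relation.Unary.All.Properties using (¬All⇒Any¬)
open import Data.Product using (∃-syntax; _×_; _,_; proj₁; proj₂)
open import Data.Sum using (_⊎_; inj₁; inj₂; [_,_]; [_,_]′)
open import Function using (_∘_; id)
open import Relation.Nullary using (yes; no; ¬?; contradiction)
open import Relation.Nullary.Decidable using (decidable-stable)
open import Relation.Binary.PropositionalEquality using (refl; sym; subst)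

private
  variable
    n : ℕ
    x : Fin n
    p q r : Subset n

x∈p─q⁻ : ∀ (p q : Subset n) → x ∈ p ─ q → x ∈ p × x ∉ q
x∈p─q⁻             (s ∷ p)      (t ∷ q)       (there x∈) =
  let x∈p , x∉q = x∈p─q⁻ p q x∈ in there x∈p , λ { (there x∈q) → x∉q x∈q }
x∈p─q⁻             (inside ∷ p) (outside ∷ q) here       = here , λ ()
x∈p─q⁻ {x = zero}  (s ∷ p)      (inside ∷ q)  ()

∣p∣≤∣q∣+∣p─q∣ : ∀ (p q : Subset n) → ∣ p ∣ ≤ ∣ q ∣ + ∣ p ─ q ∣
∣p∣≤∣q∣+∣p─q∣ []            []            = z≤n
∣p∣≤∣q∣+∣p─q∣ (inside ∷ p)  (inside ∷ q)  = s≤s (∣p∣≤∣q∣+∣p─q∣ p q)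
∣p∣≤∣q∣+∣p─q∣ (inside ∷ p)  (outside ∷ q) =
  subst (suc ∣ p ∣ ≤_) (sym (+-suc ∣ q ∣ ∣ p ─ q ∣)) (s≤s (∣p∣≤∣q∣+∣p─q∣ p q))
∣p∣≤∣q∣+∣p─q∣ (outside ∷ p) (inside ∷ q)  = ≤-trans (∣p∣≤∣q∣+∣p─q∣ p q) (n≤1+n _)
∣p∣≤∣q∣+∣p─q∣ (outside ∷ p) (outside ∷ q) = ∣p∣≤∣q∣+∣p─q∣ p q

p∩q⊆r⇒p─r⊆p─q : p ∩ q ⊆ r → p ─ r ⊆ p ─ q
p∩q⊆r⇒p─r⊆p─q {p = p} {r = r} p∩q⊆r x∈ =
  let x∈p , x∉r = x∈p─q⁻ p r x∈
  in  x∈p∧x∉q⇒x∈p─q x∈p (x∉r ∘ p∩q⊆r ∘ x∈p∩q⁺ ∘ (x∈p ,_))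

─-monoˡ-⊆ : p ⊆ q → p ─ r ⊆ q ─ r
─-monoˡ-⊆ {p = p} {r = r} p⊆q x∈ = let x∈p , x∉r = x∈p─q⁻ p r x∈ in x∈p∧x∉q⇒x∈p─q (p⊆q x∈p) x∉r

[[p─q]∪r]∩q≡r : ∀ (p q r : Subset n) → r ⊆ q → ((p ─ q) ∪ r) ∩ q ≡ r
[[p─q]∪r]∩q≡r p q r r⊆q = ⊆-antisym ⊆r (λ x∈r → x∈p∩q⁺ (x∈p∪q⁺ (inj₂ x∈r) , r⊆q x∈r))
  where
  ⊆r : ((p ─ q) ∪ r) ∩ q ⊆ r
  ⊆r x∈ with x∈p∩q⁻ ((p ─ q) ∪ r) q x∈
  ... | x∈p─q∪r , x∈q with x∈p∪q⁻ (p ─ q) r x∈p─q∪r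
  ...   | inj₁ x∈p─q = contradiction x∈q (proj₂ (x∈p─q⁻ p q x∈p─q))
  ...   | inj₂ x∈r   = x∈r

[p─q]∪r─r≡p─q : ∀ (p q r : Subset n) → r ⊆ q → (p ─ q) ∪ r ─ r ≡ p ─ q
[p─q]∪r─r≡p─q p q r r⊆q = ⊆-antisym ⊆p─q ⊇p─q
  where
  ⊆p─q : (p ─ q) ∪ r ─ r ⊆ p ─ q
  ⊆p─q x∈ with x∈p─q⁻ ((p ─ q) ∪ r) r x∈
  ... | x∈p─q∪r , x∉r with x∈p∪q⁻ (p ─ q) r x∈p─q∪r
  ...   | inj₁ x∈p─q = x∈p─q
  ...   | inj₂ x∈r   = contradiction x∈r x∉r
  ⊇p─q : p ─ q ⊆ (p ─ q) ∪ r ─ r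
  ⊇p─q x∈ = x∈p∧x∉q⇒x∈p─q (x∈p∪q⁺ (inj₁ x∈)) (proj₂ (x∈p─q⁻ p q x∈) ∘ r⊆q)

minimum-≤ : ∀ {xs : List ℕ} {z} → z List.∈ xs → minimum xs ≤ z
minimum-≤ {x ∷ xs} {z} z∈ = foldr-preservesᵒ ⊓-≤ x xs (split z∈)
  where
  ⊓-≤ : ∀ a b → a ≤ z ⊎ b ≤ z → a ⊓ b ≤ z
  ⊓-≤ a b = [ ≤-trans (m⊓n≤m a b) , ≤-trans (m⊓n≤n a b) ]
  split : z List.∈ x ∷ xs → x ≤ z ⊎ Any.Any (_≤ z) xs
  split (here refl) = inj₁ ≤-refl
  split (there z∈xs) = inj₂ (Any.map (λ { refl → ≤-refl }) z∈xs)

minimum-∈ : ∀ {xs : List ℕ} {z} → z List.∈ xs → minimum xs List.∈ xs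
minimum-∈ {x ∷ xs} _ = [ here , there ]′ (foldr-selective ⊓-sel x xs)

≢[]⇒∃∈ : ∀ {A : Set} {xs : List A} → ¬ xs ≡ [] → ∃[ x ] x List.∈ xs
≢[]⇒∃∈ {xs = []}    xs≢[] = contradiction refl xs≢[]
≢[]⇒∃∈ {xs = x ∷ _} _     = x , here refl

module _ (ℱ : Family n) where

  ∈-bases⇒∈ : ∀ {B} → B List.∈ bases ℱ → B List.∈ ℱ
  ∈-bases⇒∈ = proj₁ ∘ ∈-filter⁻ (maximal? ℱ) {xs = ℱ}

  base-⊄ : ∀ {A B} → B List.∈ bases ℱ → A List.∈ ℱ → ¬ B ⊂ A
  base-⊄ B∈ = lookup (proj₂ (∈-filter⁻ (maximal? ℱ) {xs = ℱ} B∈))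

  base-⊆⇒⊇ : ∀ {A B} → B List.∈ bases ℱ → A List.∈ ℱ → B ⊆ A → A ⊆ B
  base-⊆⇒⊇ {B = B} B∈ A∈ B⊆A {x} x∈A with x ∈? B
  ... | yes x∈B = x∈B
  ... | no  x∉B = contradiction ((λ {_} → B⊆A) , x , x∈A , x∉B) (base-⊄ B∈ A∈)

  μ≤∣base∣ : ∀ {B} → B List.∈ bases ℱ → μ ℱ ≤ ∣ B ∣
  μ≤∣base∣ = minimum-≤ ∘ ∈-map⁺ ∣_∣

  ⊆-base : ∀ {A} → A List.∈ ℱ → ∃[ B ] B List.∈ bases ℱ × A ⊆ B
  ⊆-base {A} = go A (⊃-wellFounded A)
    where
    go : ∀ A → Acc _⊃_ A → A List.∈ ℱ → ∃[ B ] B List.∈ bases ℱ × A ⊆ B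
    go A (acc below) A∈ with maximal? ℱ A
    ... | yes A-max = A , ∈-filter⁺ (maximal? ℱ) A∈ A-max , id
    ... | no ¬A-max with List.find (¬All⇒Any¬ (λ C → ¬? (A ⊂? C)) ℱ ¬A-max)
    ...   | C , C∈ , ¬A⊄C =
      let A⊂C = decidable-stable (A ⊂? C) ¬A⊄C
          B , B∈ , C⊆B = go C (below A⊂C) C∈
      in  B , B∈ , C⊆B ∘ p⊂q⇒p⊆q A⊂C

  μ-attained : ∀ {A} → A List.∈ ℱ → ∃[ B ] B List.∈ bases ℱ × μ ℱ ≡ ∣ B ∣
  μ-attained A∈ =
    let B , B∈ , _ = ⊆-base A∈
    in  ∈-map⁻ ∣_∣ (minimum-∈ (∈-map⁺ ∣_∣ B∈))

module _ (ℋ : Family n) (X Y : Subset n) where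

  ∈-restrict⁻ : ∀ {G} → G List.∈ restrict ℋ X Y → G List.∈ ℋ × G ∩ Y ≡ X
  ∈-restrict⁻ = ∈-filter⁻ (λ H → (H ∩ Y) ≟ˢ X) {xs = ℋ}

  ∈-restrict⁺ : ∀ {G} → G List.∈ ℋ → G ∩ Y ≡ X → G List.∈ restrict ℋ X Y
  ∈-restrict⁺ = ∈-filter⁺ (λ H → (H ∩ Y) ≟ˢ X) {xs = ℋ}

  M─Y∈removeAll-restrict : Hereditary ℋ → X ⊆ Y → ∀ {M} → M List.∈ ℋ → X ⊆ M
                         → M ─ Y List.∈ removeAll (restrict ℋ X Y) X
  M─Y∈removeAll-restrict hered X⊆Y {M} M∈ X⊆M =
    subst (List._∈ removeAll (restrict ℋ X Y) X) ([p─q]∪r─r≡p─q M Y X X⊆Y) (∈-map⁺ (_─ X) H∈𝒢)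
    where
    H⊆M : (M ─ Y) ∪ X ⊆ M
    H⊆M x∈ = [ p─q⊆p M Y , X⊆M ]′ (x∈p∪q⁻ (M ─ Y) X x∈)
    H∈𝒢 : (M ─ Y) ∪ X List.∈ restrict ℋ X Y
    H∈𝒢 = ∈-restrict⁺ (hered M∈ H⊆M) ([[p─q]∪r]∩q≡r M Y X X⊆Y)

  μ≤∣Y∣+∣base∣ : Hereditary ℋ → X ⊆ Y → ∀ {B} → B List.∈ bases (removeAll (restrict ℋ X Y) X)
               → μ ℋ ≤ ∣ Y ∣ + ∣ B ∣
  μ≤∣Y∣+∣base∣ hered X⊆Y B∈ with ∈-map⁻ (_─ X) (∈-bases⇒∈ _ B∈)
  ... | G , G∈𝒢 , refl with ∈-restrict⁻ G∈𝒢
  ... | G∈ℋ , G∩Y≡X with ⊆-base ℋ G∈ℋ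
  ... | M , M-base , G⊆M = begin
    μ ℋ               ≤⟨ μ≤∣base∣ ℋ M-base ⟩
    ∣ M ∣             ≤⟨ ∣p∣≤∣q∣+∣p─q∣ M Y ⟩
    ∣ Y ∣ + ∣ M ─ Y ∣ ≤⟨ +-monoʳ-≤ ∣ Y ∣ (p⊆q⇒∣p∣≤∣q∣ M─Y⊆G─X) ⟩
    ∣ Y ∣ + ∣ G ─ X ∣ ∎
    where
    open ≤-Reasoning
    X⊆M : X ⊆ M
    X⊆M = G⊆M ∘ proj₁ ∘ x∈p∩q⁻ G Y ∘ subst (_ ∈_) (sym G∩Y≡X)
    G─X⊆M─Y : G ─ X ⊆ M ─ Y
    G─X⊆M─Y = ─-monoˡ-⊆ G⊆M ∘ p∩q⊆r⇒p─r⊆p─q (⊆-reflexive G∩Y≡X)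
    M─Y⊆G─X : M ─ Y ⊆ G ─ X
    M─Y⊆G─X = base-⊆⇒⊇ _ B∈ (M─Y∈removeAll-restrict hered X⊆Y (∈-bases⇒∈ ℋ M-base) X⊆M) G─X⊆M─Y

lemma2p2 : ∀ {n : ℕ} (ℋ : Family n) (X Y : Subset n) → Hereditary ℋ → X ⊆ Y
    → ¬ (restrict ℋ X Y ≡ [])
    → μ ℋ ∸ ∣ Y ∣ ≤ μ (removeAll (restrict ℋ X Y) X)
lemma2p2 ℋ X Y hered X⊆Y 𝒢≢[] =
  let G , G∈𝒢       = ≢[]⇒∃∈ 𝒢≢[]
      B , B∈ , μ≡∣B∣ = μ-attained _ (∈-map⁺ (_─ X) G∈𝒢)
  in  subst (μ ℋ ∸ ∣ Y ∣ ≤_) (sym μ≡∣B∣)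
        (m≤n+o⇒m∸n≤o (μ ℋ) ∣ Y ∣ (μ≤∣Y∣+∣base∣ ℋ X Y hered X⊆Y B∈))
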